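{- Let $m\ge1$ be an integer. Then, as formal power series, \[\gamma_m(x)=\frac{2x}{1-\sqrt{1-4x}}\left(1+\sum_{n=1}^{\infty}\left(\prod_{k=1}^{m}\frac{n+m-k+1}{k}\right)\left(\prod_{k=m+2}^{n+m+1}\frac{n+m+k+1}{k}\right)x^n\right).\]
   Context: A path is a finite sequence of points of $\mathbb{Z}^2$ in which each step is $(1,0)$ or $(0,1)$. For integers $0\le m\le n$, $\mathcal{C}_{n,m}$ denotes the number of paths from $(0,-2m)$ to $(n-m,n-m)$ not crossing the line $y=x$, i.e. all of whose points $(p,q)$ satisfy $q\le p$. For $m\ge0$, $\gamma_m(x)=\sum_{n\ge0}\mathcal{C}_{n+m,m}x^n$. Here $\sqrt{1-4x}$ is the formal power series with constant term $1$ whose square is $1-4x$, and $\frac{2x}{1-\sqrt{1-4x}}$ denotes the multiplicative inverse of the formal power series $\frac{1-\sqrt{1-4x}}{2x}$ (which has constant term $1$). -}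

module Defs where

open import Data.Nat as ℕ using (ℕ; zero; suc; _∸_)
open import Data.Integer as ℤ using (ℤ; +_; _≤?_; _≟_)
open import Data.Rational as ℚ using (ℚ; 0ℚ; 1ℚ; ½; _/_)
open import Relation.Nullary using (yes; no)
open import Relation.Binary.PropositionalEquality using (_≡_)

-- pathsFrom s p q tp tq : number of paths with exactly s unit steps
-- ((1,0) or (0,1)) starting at (p,q) and ending at (tp,tq), all of whose
-- points (a,b) satisfy b ≤ a.
pathsFrom : ℕ → ℤ → ℤ → ℤ → ℤ → ℕ
pathsFrom s p q tp tq with q ≤? p
... | no _ = 0
pathsFrom zero p q tp tq | yes _ with p ≟ tp | q ≟ tq
... | yes _ | yes _ = 1
... | _ | _ = 0
pathsFrom (suc s) p q tp tq | yes _ =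
  pathsFrom s (p ℤ.+ + 1) q tp tq ℕ.+ pathsFrom s p (q ℤ.+ + 1) tp tq

-- C n m : number of paths from (0,-2m) to (n-m,n-m) not crossing y = x.
-- (Any such path has exactly (n-m) + (n-m+2m) = 2n steps.)
C : ℕ → ℕ → ℕ
C n m = pathsFrom (2 ℕ.* n) (+ 0) (ℤ.- (+ (2 ℕ.* m))) (+ (n ∸ m)) (+ (n ∸ m))

FPS : Set
FPS = ℕ → ℚ

sumTo : ℕ → (ℕ → ℚ) → ℚ
sumTo zero f = f 0
sumTo (suc n) f = sumTo n f ℚ.+ f (suc n)

_⋆_ : FPS → FPS → FPS
(f ⋆ g) n = sumTo n (λ i → f i ℚ.* g (n ∸ i))

one : FPS
one zero = 1ℚ
one (suc _) = 0ℚ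

oneMinus4x : FPS
oneMinus4x zero = 1ℚ
oneMinus4x (suc zero) = ℚ.- (+ 4 / 1)
oneMinus4x (suc (suc _)) = 0ℚ

-- (1 - S)/(2x), for a series S with constant term 1:
-- coefficient n is -(S_{n+1})/2.
oneMinusOver2x : FPS → FPS
oneMinusOver2x S n = (ℚ.- S (suc n)) ℚ.* ½

γ : ℕ → FPS
γ m n = + C (n ℕ.+ m) m / 1

-- ∏_{k=a}^{b} f k  (empty product = 1 when b < a)
prodFromTo : ℕ → ℕ → (ℕ → ℚ) → ℚ
prodFromTo a zero f with a
... | zero = f 0
... | suc _ = 1ℚ
prodFromTo a (suc b) f with a ℕ.≤? suc b
... | yes _ = prodFromTo a b f ℚ.* f (suc b)
... | no _ = 1ℚ

B : ℕ → FPS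
B m zero = 1ℚ
B m (suc n') =
  prodFromTo 1 m (λ k → frac (n ℕ.+ m ∸ k ℕ.+ 1) k)
  ℚ.* prodFromTo (m ℕ.+ 2) (n ℕ.+ m ℕ.+ 1) (λ k → frac (n ℕ.+ m ℕ.+ k ℕ.+ 1) k)
  where
  n = suc n'
  -- a / k, only used with k ≥ 1 (k = 0 gives 0, never reached)
  frac : ℕ → ℕ → ℚ
  frac a zero = 0ℚ
  frac a (suc k) = + a / suc k

{-# OPTIONS --safe #-}
module Submission where

-- Write c = (1 - S)/(2x).  The hypotheses on S say that c has constant term 1 and
-- c = 1 + x c², so c is the Catalan series and T is its inverse.  Since
-- c^(k+1) = c^k + x c^(k+2), the coefficients of c^(d+1) satisfy the recurrence of
-- `ballot`, which is also the first-step recurrence for paths starting d units below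
-- the diagonal; hence γ_m = c^(2m+1).  The closed form
-- ballot d a · a! · (a+d+1)! = (d+1) · (2a+d)! identifies the products in the right-hand
-- series with the coefficients of c^(2m+2), so T · B_m = c^(2m+1) = γ_m.

open import Function using (_∘_; const)
open import Data.Nat as ℕ using (ℕ; zero; suc; _∸_; _≤_; _<_; _≤′_; _!; NonZero)
import Data.Nat.Properties as ℕP
import Data.Nat.Tactic.RingSolver as ℕ-Tactic
open import Data.Integer as ℤ using (+_)
import Data.Integer.Properties as ℤP
import Data.Integer.Tactic.RingSolver as ℤ-Tactic
open import Data.Rational using (ℚ; 0ℚ; 1ℚ; ½; _/_; _+_; _*_; -_; toℚᵘ)
import Data.Rational.Properties as ℚP
open import Data.Rational.Unnormalised as ℚᵘ using (mkℚᵘ; *≡*) renaming (_≃_ to _≃ᵘ_)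
import Data.Rational.Unnormalised.Properties as ℚᵘP
open import Relation.Binary.PropositionalEquality
open import Relation.Nullary using (yes; no; ¬_)
open import Data.Empty using (⊥-elim)
open import Data.Rational.Solver using (module +-*-Solver)
open +-*-Solver using (solve; _:+_; _:*_; :-_; _:=_)
open import Algebra.Bundles using (CommutativeMonoid)
import Algebra.Properties.CommutativeSemigroup as CommSemigroupProperties

open import Defs

fromℕ : ℕ → ℚ
fromℕ n = + n / 1

private
  toℚᵘ-/ : ∀ a d → toℚᵘ (+ a / suc d) ≃ᵘ mkℚᵘ (+ a) d
  toℚᵘ-/ a d = ℚP.toℚᵘ-fromℚᵘ (mkℚᵘ (+ a) d)

fromℕ-*-/ : ∀ a b c k → a ℕ.* b ≡ c ℕ.* suc k → fromℕ a * (+ b / suc k) ≡ fromℕ c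
fromℕ-*-/ a b c k eq = ℚP.toℚᵘ-injective (let open ℚᵘP.≃-Reasoning in begin
  toℚᵘ (fromℕ a * (+ b / suc k))          ≈⟨ ℚP.toℚᵘ-homo-* (fromℕ a) (+ b / suc k) ⟩
  toℚᵘ (fromℕ a) ℚᵘ.* toℚᵘ (+ b / suc k)  ≈⟨ ℚᵘP.*-cong (toℚᵘ-/ a 0) (toℚᵘ-/ b k) ⟩
  mkℚᵘ (+ a) 0 ℚᵘ.* mkℚᵘ (+ b) k          ≈⟨ *≡* cross ⟩
  mkℚᵘ (+ c) 0                            ≈⟨ ℚᵘP.≃-sym (toℚᵘ-/ c 0) ⟩
  toℚᵘ (fromℕ c)                          ∎)
  where
  cross : (+ a ℤ.* + b) ℤ.* + 1 ≡ + c ℤ.* + (1 ℕ.* suc k)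
  cross = begin
    (+ a ℤ.* + b) ℤ.* + 1  ≡⟨ ℤP.*-identityʳ _ ⟩
    + a ℤ.* + b            ≡⟨ ℤP.pos-* a b ⟨
    + (a ℕ.* b)            ≡⟨ cong +_ eq ⟩
    + (c ℕ.* suc k)        ≡⟨ ℤP.pos-* c (suc k) ⟩
    + c ℤ.* + suc k        ≡⟨ cong (λ d → + c ℤ.* + d) (ℕP.*-identityˡ (suc k)) ⟨
    + c ℤ.* + (1 ℕ.* suc k) ∎
    where open ≡-Reasoning

fromℕ-* : ∀ a b → fromℕ (a ℕ.* b) ≡ fromℕ a * fromℕ b
fromℕ-* a b = sym (fromℕ-*-/ a b (a ℕ.* b) 0 (sym (ℕP.*-identityʳ (a ℕ.* b))))

fromℕ-+ : ∀ a b → fromℕ (a ℕ.+ b) ≡ fromℕ a + fromℕ b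
fromℕ-+ a b = ℚP.toℚᵘ-injective (let open ℚᵘP.≃-Reasoning in begin
  toℚᵘ (fromℕ (a ℕ.+ b))                ≈⟨ toℚᵘ-/ (a ℕ.+ b) 0 ⟩
  mkℚᵘ (+ (a ℕ.+ b)) 0                  ≈⟨ *≡* cross ⟩
  mkℚᵘ (+ a) 0 ℚᵘ.+ mkℚᵘ (+ b) 0        ≈⟨ ℚᵘP.+-cong (toℚᵘ-/ a 0) (toℚᵘ-/ b 0) ⟨
  toℚᵘ (fromℕ a) ℚᵘ.+ toℚᵘ (fromℕ b)    ≈⟨ ℚP.toℚᵘ-homo-+ (fromℕ a) (fromℕ b) ⟨
  toℚᵘ (fromℕ a + fromℕ b)              ∎)
  where
  cross : + (a ℕ.+ b) ℤ.* + 1 ≡ (+ a ℤ.* + 1 ℤ.+ + b ℤ.* + 1) ℤ.* + 1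
  cross = trans (cong (ℤ._* + 1) (ℤP.pos-+ a b)) (distrib (+ a) (+ b))
    where
    distrib : ∀ x y → (x ℤ.+ y) ℤ.* + 1 ≡ (x ℤ.* + 1 ℤ.+ y ℤ.* + 1) ℤ.* + 1
    distrib = ℤ-Tactic.solve-∀

*-cancelʳ-fromℕ : ∀ {x y} w .{{_ : NonZero w}} → x * fromℕ w ≡ y * fromℕ w → x ≡ y
*-cancelʳ-fromℕ {x} {y} (suc k) eq = begin
  x                          ≡⟨ undo x ⟨
  x * fromℕ (suc k) * w⁻¹    ≡⟨ cong (_* w⁻¹) eq ⟩
  y * fromℕ (suc k) * w⁻¹    ≡⟨ undo y ⟩
  y                          ∎
  where
  open ≡-Reasoning
  w⁻¹ : ℚ
  w⁻¹ = + 1 / suc k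
  undo : ∀ z → z * fromℕ (suc k) * w⁻¹ ≡ z
  undo z = begin
    z * fromℕ (suc k) * w⁻¹    ≡⟨ ℚP.*-assoc z (fromℕ (suc k)) w⁻¹ ⟩
    z * (fromℕ (suc k) * w⁻¹)  ≡⟨ cong (z *_) (fromℕ-*-/ (suc k) 1 1 k (ℕP.*-comm (suc k) 1)) ⟩
    z * 1ℚ                     ≡⟨ ℚP.*-identityʳ z ⟩
    z                          ∎

double*½ : ∀ x → (x + x) * ½ ≡ x
double*½ x = begin
  (x + x) * ½   ≡⟨ ℚP.*-distribʳ-+ ½ x x ⟩
  x * ½ + x * ½ ≡⟨ ℚP.*-distribˡ-+ x ½ ½ ⟨
  x * (½ + ½)   ≡⟨ ℚP.*-identityʳ x ⟩
  x             ∎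
  where open ≡-Reasoning

private
  module +-Properties = CommSemigroupProperties (CommutativeMonoid.commutativeSemigroup ℚP.+-0-commutativeMonoid)
  module *-Properties = CommSemigroupProperties (CommutativeMonoid.commutativeSemigroup ℚP.*-1-commutativeMonoid)

conv : FPS → FPS → FPS
conv f g zero    = f 0 * g 0
conv f g (suc n) = f 0 * g (suc n) + conv (f ∘ suc) g n

sumTo-suc : ∀ n h → sumTo (suc n) h ≡ h 0 + sumTo n (h ∘ suc)
sumTo-suc zero    h = refl
sumTo-suc (suc n) h = trans (cong (_+ h (suc (suc n))) (sumTo-suc n h)) (ℚP.+-assoc (h 0) _ _)

⋆≗conv : ∀ f g → f ⋆ g ≗ conv f g
⋆≗conv f g zero    = refl
⋆≗conv f g (suc n) = trans (sumTo-suc n (λ i → f i * g (suc n ∸ i)))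
  (cong (_+_ (f 0 * g (suc n))) (⋆≗conv (f ∘ suc) g n))

conv-cong : ∀ {f f′ g g′} → f ≗ f′ → g ≗ g′ → conv f g ≗ conv f′ g′
conv-cong f≗f′ g≗g′ zero    = cong₂ _*_ (f≗f′ 0) (g≗g′ 0)
conv-cong f≗f′ g≗g′ (suc n) =
  cong₂ _+_ (cong₂ _*_ (f≗f′ 0) (g≗g′ (suc n))) (conv-cong (f≗f′ ∘ suc) g≗g′ n)

conv-zeroˡ : ∀ g → conv (const 0ℚ) g ≗ const 0ℚ
conv-zeroˡ g zero    = ℚP.*-zeroˡ (g 0)
conv-zeroˡ g (suc n) = cong₂ _+_ (ℚP.*-zeroˡ (g (suc n))) (conv-zeroˡ g n)

conv-identityˡ : ∀ g → conv one g ≗ g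
conv-identityˡ g zero    = ℚP.*-identityˡ (g 0)
conv-identityˡ g (suc n) = begin
  1ℚ * g (suc n) + conv (const 0ℚ) g n  ≡⟨ cong₂ _+_ (ℚP.*-identityˡ (g (suc n))) (conv-zeroˡ g n) ⟩
  g (suc n) + 0ℚ                        ≡⟨ ℚP.+-identityʳ (g (suc n)) ⟩
  g (suc n)                             ∎
  where open ≡-Reasoning

conv-distribʳ-+ : ∀ f g h n → conv (λ i → f i + g i) h n ≡ conv f h n + conv g h n
conv-distribʳ-+ f g h zero    = ℚP.*-distribʳ-+ (h 0) (f 0) (g 0)
conv-distribʳ-+ f g h (suc n) = begin
  (f 0 + g 0) * h (suc n) + conv (λ i → f (suc i) + g (suc i)) h n
    ≡⟨ cong₂ _+_ (ℚP.*-distribʳ-+ (h (suc n)) (f 0) (g 0)) (conv-distribʳ-+ (f ∘ suc) (g ∘ suc) h n) ⟩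
  (f 0 * h (suc n) + g 0 * h (suc n)) + (conv (f ∘ suc) h n + conv (g ∘ suc) h n)
    ≡⟨ +-Properties.interchange (f 0 * h (suc n)) (g 0 * h (suc n)) (conv (f ∘ suc) h n) (conv (g ∘ suc) h n) ⟩
  (f 0 * h (suc n) + conv (f ∘ suc) h n) + (g 0 * h (suc n) + conv (g ∘ suc) h n) ∎
  where open ≡-Reasoning

conv-scaleˡ : ∀ a f g n → conv (λ i → a * f i) g n ≡ a * conv f g n
conv-scaleˡ a f g zero    = ℚP.*-assoc a (f 0) (g 0)
conv-scaleˡ a f g (suc n) = begin
  a * f 0 * g (suc n) + conv (λ i → a * f (suc i)) g n
    ≡⟨ cong₂ _+_ (ℚP.*-assoc a (f 0) (g (suc n))) (conv-scaleˡ a (f ∘ suc) g n) ⟩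
  a * (f 0 * g (suc n)) + a * conv (f ∘ suc) g n
    ≡⟨ ℚP.*-distribˡ-+ a _ _ ⟨
  a * (f 0 * g (suc n) + conv (f ∘ suc) g n) ∎
  where open ≡-Reasoning

conv-scaleʳ : ∀ a f g n → conv f (λ i → a * g i) n ≡ a * conv f g n
conv-scaleʳ a f g zero    = *-Properties.x∙yz≈y∙xz (f 0) a (g 0)
conv-scaleʳ a f g (suc n) = begin
  f 0 * (a * g (suc n)) + conv (f ∘ suc) (λ i → a * g i) n
    ≡⟨ cong₂ _+_ (*-Properties.x∙yz≈y∙xz (f 0) a (g (suc n))) (conv-scaleʳ a (f ∘ suc) g n) ⟩
  a * (f 0 * g (suc n)) + a * conv (f ∘ suc) g n
    ≡⟨ ℚP.*-distribˡ-+ a _ _ ⟨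
  a * (f 0 * g (suc n) + conv (f ∘ suc) g n) ∎
  where open ≡-Reasoning

conv-assoc : ∀ f g h n → conv (conv f g) h n ≡ conv f (conv g h) n
conv-assoc f g h zero    = ℚP.*-assoc (f 0) (g 0) (h 0)
conv-assoc f g h (suc n) = begin
  f 0 * g 0 * h (suc n) + conv (λ i → f 0 * g (suc i) + conv (f ∘ suc) g i) h n
    ≡⟨ cong (_+_ (f 0 * g 0 * h (suc n))) (conv-distribʳ-+ _ _ h n) ⟩
  f 0 * g 0 * h (suc n) + (conv (λ i → f 0 * g (suc i)) h n + conv (conv (f ∘ suc) g) h n)
    ≡⟨ cong₂ (λ u v → f 0 * g 0 * h (suc n) + (u + v))
             (conv-scaleˡ (f 0) (g ∘ suc) h n) (conv-assoc (f ∘ suc) g h n) ⟩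
  f 0 * g 0 * h (suc n) + (f 0 * conv (g ∘ suc) h n + conv (f ∘ suc) (conv g h) n)
    ≡⟨ regroup (f 0) (g 0) (h (suc n)) _ _ ⟩
  f 0 * (g 0 * h (suc n) + conv (g ∘ suc) h n) + conv (f ∘ suc) (conv g h) n ∎
  where
  open ≡-Reasoning
  regroup : ∀ a b c d e → a * b * c + (a * d + e) ≡ a * (b * c + d) + e
  regroup = solve 5 (λ a b c d e → a :* b :* c :+ (a :* d :+ e) := a :* (b :* c :+ d) :+ e) refl

conv-suc-last : ∀ f g n → conv f g (suc n) ≡ conv f (g ∘ suc) n + f (suc n) * g 0
conv-suc-last f g zero    = refl
conv-suc-last f g (suc n) = begin
  f 0 * g (suc (suc n)) + conv (f ∘ suc) g (suc n)
    ≡⟨ cong (_+_ (f 0 * g (suc (suc n)))) (conv-suc-last (f ∘ suc) g n) ⟩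
  f 0 * g (suc (suc n)) + (conv (f ∘ suc) (g ∘ suc) n + f (suc (suc n)) * g 0)
    ≡⟨ ℚP.+-assoc (f 0 * g (suc (suc n))) (conv (f ∘ suc) (g ∘ suc) n) (f (suc (suc n)) * g 0) ⟨
  f 0 * g (suc (suc n)) + conv (f ∘ suc) (g ∘ suc) n + f (suc (suc n)) * g 0 ∎
  where open ≡-Reasoning

-- Lattice paths and ballot numbers

ballot : ℕ → ℕ → ℕ
ballot d       zero    = 1
ballot zero    (suc a) = ballot 1 a
ballot (suc d) (suc a) = ballot (suc (suc d)) a ℕ.+ ballot d (suc a)

i<i+1 : ∀ i → i ℤ.< i ℤ.+ + 1
i<i+1 i = ℤP.suc[i]≤j⇒i<j (ℤP.≤-reflexive (ℤP.+-comm (+ 1) i))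

pathsFrom-above : ∀ s p q tp tq → ¬ (q ℤ.≤ p) → pathsFrom s p q tp tq ≡ 0
pathsFrom-above s p q tp tq q≰p with q ℤ.≤? p
... | yes q≤p = ⊥-elim (q≰p q≤p)
... | no _    = refl

pathsFrom-suc : ∀ s p q tp tq → q ℤ.≤ p →
  pathsFrom (suc s) p q tp tq ≡ pathsFrom s (p ℤ.+ + 1) q tp tq ℕ.+ pathsFrom s p (q ℤ.+ + 1) tp tq
pathsFrom-suc s p q tp tq q≤p with q ℤ.≤? p
... | yes _   = refl
... | no q≰p  = ⊥-elim (q≰p q≤p)

pathsFrom-past : ∀ s p q tp tq → tp ℤ.< p → pathsFrom s p q tp tq ≡ 0
pathsFrom-past zero p q tp tq tp<p with q ℤ.≤? p
... | no _ = refl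
... | yes _ with p ℤ.≟ tp
...   | yes p≡tp = ⊥-elim (ℤP.<-irrefl (sym p≡tp) tp<p)
...   | no _     = refl
pathsFrom-past (suc s) p q tp tq tp<p with q ℤ.≤? p
... | no _  = refl
... | yes _ = cong₂ ℕ._+_ (pathsFrom-past s (p ℤ.+ + 1) q tp tq (ℤP.<-trans tp<p (i<i+1 p)))
                            (pathsFrom-past s p (q ℤ.+ + 1) tp tq tp<p)

pathsFrom-zero-diagonal : ∀ {p q t} → p ≡ q → t ≡ q → pathsFrom 0 p q t t ≡ 1
pathsFrom-zero-diagonal {q = q} refl refl with q ℤ.≤? q
... | no q≰q = ⊥-elim (q≰q ℤP.≤-refl)
... | yes _ with q ℤ.≟ q
...   | no q≢q = ⊥-elim (q≢q refl)
...   | yes _  = refl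

private
  step-right : ∀ x n {y} → x ℤ.+ + n ≡ y → x ℤ.+ + suc n ≡ y ℤ.+ + 1
  step-right x n x+n≡y = begin
    x ℤ.+ + suc n        ≡⟨ cong (λ k → x ℤ.+ + k) (ℕP.+-comm 1 n) ⟩
    x ℤ.+ (+ n ℤ.+ + 1)  ≡⟨ ℤP.+-assoc x (+ n) (+ 1) ⟨
    x ℤ.+ + n ℤ.+ + 1    ≡⟨ cong (ℤ._+ + 1) x+n≡y ⟩
    _                    ∎
    where open ≡-Reasoning

  step-left : ∀ x n {y} → x ℤ.+ + suc n ≡ y → (x ℤ.+ + 1) ℤ.+ + n ≡ y
  step-left x n = trans (ℤP.+-assoc x (+ 1) (+ n))

  on-diagonal : ∀ x {y} → x ℤ.+ + 0 ≡ y → y ≡ x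
  on-diagonal x x+0≡y = trans (sym x+0≡y) (ℤP.+-identityʳ x)

  below-diagonal : ∀ {p q} d → q ℤ.+ + d ≡ p → q ℤ.≤ p
  below-diagonal {q = q} d q+d≡p = subst (q ℤ.≤_) q+d≡p (ℤP.i≤i+j q (+ d))

pathsFrom-ballot : ∀ s a d p q t → q ℤ.+ + d ≡ p → p ℤ.+ + a ≡ t → s ≡ a ℕ.+ a ℕ.+ d →
  pathsFrom s p q t t ≡ ballot d a
pathsFrom-ballot zero zero zero p q t q+0≡p p+0≡t refl =
  pathsFrom-zero-diagonal (on-diagonal q q+0≡p) (trans (on-diagonal p p+0≡t) (on-diagonal q q+0≡p))
pathsFrom-ballot (suc s) zero (suc d) p q t q+d≡p p+0≡t steps = begin
  pathsFrom (suc s) p q t t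
    ≡⟨ pathsFrom-suc s p q t t (below-diagonal (suc d) q+d≡p) ⟩
  pathsFrom s (p ℤ.+ + 1) q t t ℕ.+ pathsFrom s p (q ℤ.+ + 1) t t
    ≡⟨ cong₂ ℕ._+_ (pathsFrom-past s (p ℤ.+ + 1) q t t t<p+1)
                   (pathsFrom-ballot s zero d p (q ℤ.+ + 1) t (step-left q d q+d≡p) p+0≡t (ℕP.suc-injective steps)) ⟩
  ballot (suc d) zero ∎
  where
  open ≡-Reasoning
  t<p+1 : t ℤ.< p ℤ.+ + 1
  t<p+1 = subst (ℤ._< p ℤ.+ + 1) (sym (on-diagonal p p+0≡t)) (i<i+1 p)
pathsFrom-ballot (suc s) (suc a) zero p q t q+0≡p p+a≡t steps = begin
  pathsFrom (suc s) p q t t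
    ≡⟨ pathsFrom-suc s p q t t (below-diagonal 0 q+0≡p) ⟩
  pathsFrom s (p ℤ.+ + 1) q t t ℕ.+ pathsFrom s p (q ℤ.+ + 1) t t
    ≡⟨ cong₂ ℕ._+_ (pathsFrom-ballot s a 1 (p ℤ.+ + 1) q t (step-right q 0 q+0≡p) (step-left p a p+a≡t)
                                     (trans (ℕP.suc-injective steps) (regroup a)))
                   (pathsFrom-above s p (q ℤ.+ + 1) t t q+1≰p) ⟩
  ballot 1 a ℕ.+ 0
    ≡⟨ ℕP.+-identityʳ (ballot 1 a) ⟩
  ballot zero (suc a) ∎
  where
  open ≡-Reasoning
  regroup : ∀ a → a ℕ.+ suc a ℕ.+ 0 ≡ a ℕ.+ a ℕ.+ 1
  regroup = ℕ-Tactic.solve-∀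
  q+1≰p : ¬ (q ℤ.+ + 1 ℤ.≤ p)
  q+1≰p = subst (λ x → ¬ (q ℤ.+ + 1 ℤ.≤ x)) (sym (on-diagonal q q+0≡p)) (ℤP.<⇒≱ (i<i+1 q))
pathsFrom-ballot (suc s) (suc a) (suc d) p q t q+d≡p p+a≡t steps = begin
  pathsFrom (suc s) p q t t
    ≡⟨ pathsFrom-suc s p q t t (below-diagonal (suc d) q+d≡p) ⟩
  pathsFrom s (p ℤ.+ + 1) q t t ℕ.+ pathsFrom s p (q ℤ.+ + 1) t t
    ≡⟨ cong₂ ℕ._+_ (pathsFrom-ballot s a (suc (suc d)) (p ℤ.+ + 1) q t (step-right q (suc d) q+d≡p) (step-left p a p+a≡t)
                                     (trans (ℕP.suc-injective steps) (regroupʳ a d)))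
                   (pathsFrom-ballot s (suc a) d p (q ℤ.+ + 1) t (step-left q d q+d≡p) p+a≡t
                                     (trans (ℕP.suc-injective steps) (regroupᵘ a d))) ⟩
  ballot (suc d) (suc a) ∎
  where
  open ≡-Reasoning
  regroupʳ : ∀ a d → a ℕ.+ suc a ℕ.+ suc d ≡ a ℕ.+ a ℕ.+ suc (suc d)
  regroupʳ = ℕ-Tactic.solve-∀
  regroupᵘ : ∀ a d → a ℕ.+ suc a ℕ.+ suc d ≡ suc a ℕ.+ suc a ℕ.+ d
  regroupᵘ = ℕ-Tactic.solve-∀

C≡ballot : ∀ n m → C (n ℕ.+ m) m ≡ ballot (2 ℕ.* m) n
C≡ballot n m = pathsFrom-ballot (2 ℕ.* (n ℕ.+ m)) n (2 ℕ.* m) (+ 0) (ℤ.- (+ (2 ℕ.* m))) (+ (n ℕ.+ m ∸ m))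
  (ℤP.+-inverseˡ (+ (2 ℕ.* m))) (cong +_ (sym (ℕP.m+n∸n≡m n m))) (steps n m)
  where
  steps : ∀ n m → 2 ℕ.* (n ℕ.+ m) ≡ n ℕ.+ n ℕ.+ 2 ℕ.* m
  steps = ℕ-Tactic.solve-∀

-- Powers of the Catalan series

module CatalanSeries (S : FPS) (S₀≡1 : S 0 ≡ 1ℚ) (S²≡1-4x : ∀ n → (S ⋆ S) n ≡ oneMinus4x n) where

  c : FPS
  c = oneMinusOver2x S

  private
    *S₀ : ∀ x → x * S 0 ≡ x
    *S₀ x = trans (cong (x *_) S₀≡1) (ℚP.*-identityʳ x)

    S²-suc : ∀ n → conv S S (suc n) ≡ S (suc n) + conv (S ∘ suc) S n
    S²-suc n = cong (_+ conv (S ∘ suc) S n) (trans (ℚP.*-comm (S 0) (S (suc n))) (*S₀ (S (suc n))))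

    S²-one : S 1 + S 1 ≡ oneMinus4x 1
    S²-one = begin
      S 1 + S 1            ≡⟨ cong (_+_ (S 1)) (*S₀ (S 1)) ⟨
      S 1 + S 1 * S 0      ≡⟨ S²-suc 0 ⟨
      conv S S 1           ≡⟨ ⋆≗conv S S 1 ⟨
      (S ⋆ S) 1            ≡⟨ S²≡1-4x 1 ⟩
      oneMinus4x 1         ∎
      where open ≡-Reasoning

    S²-suc-suc : ∀ k → S (suc (suc k)) + (conv (S ∘ suc) (S ∘ suc) k + S (suc (suc k))) ≡ 0ℚ
    S²-suc-suc k = begin
      S (2+k) + (D² + S (2+k))        ≡⟨ cong (λ z → S (2+k) + (D² + z)) (*S₀ (S (2+k))) ⟨
      S (2+k) + (D² + S (2+k) * S 0)  ≡⟨ cong (_+_ (S (2+k))) (conv-suc-last (S ∘ suc) S k) ⟨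
      S (2+k) + conv (S ∘ suc) S (suc k)  ≡⟨ S²-suc (suc k) ⟨
      conv S S (2+k)                  ≡⟨ ⋆≗conv S S (2+k) ⟨
      (S ⋆ S) (2+k)                   ≡⟨ S²≡1-4x (2+k) ⟩
      oneMinus4x (2+k)                ≡⟨⟩
      0ℚ                              ∎
      where
      open ≡-Reasoning
      2+k : ℕ
      2+k = suc (suc k)
      D² : ℚ
      D² = conv (S ∘ suc) (S ∘ suc) k

    c≗-½*S∘suc : c ≗ λ i → (- ½) * S (suc i)
    c≗-½*S∘suc i = neg-swap (S (suc i)) ½
      where
      neg-swap : ∀ x y → (- x) * y ≡ (- y) * x
      neg-swap = solve 2 (λ x y → (:- x) :* y := (:- y) :* x) refl

  c-zero : c 0 ≡ 1ℚ
  c-zero = begin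
    (- S 1) * ½                  ≡⟨ cong (λ z → (- z) * ½) (double*½ (S 1)) ⟨
    (- ((S 1 + S 1) * ½)) * ½    ≡⟨ cong (λ z → (- (z * ½)) * ½) S²-one ⟩
    (- (oneMinus4x 1 * ½)) * ½   ≡⟨⟩
    1ℚ                           ∎
    where open ≡-Reasoning

  c-suc : ∀ k → c (suc k) ≡ conv c c k
  c-suc k = begin
    (- x) * ½                      ≡⟨ cong (λ z → (- z) * ½) (double*½ x) ⟨
    (- ((x + x) * ½)) * ½          ≡⟨ rearrange ½ x ⟩
    (- ½) * ((- ½) * (- (x + x)))  ≡⟨ cong (λ z → (- ½) * ((- ½) * z)) y≡-[x+x] ⟨
    (- ½) * ((- ½) * y)            ≡⟨ cong ((- ½) *_) (conv-scaleʳ (- ½) (S ∘ suc) (S ∘ suc) k) ⟨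
    (- ½) * conv (S ∘ suc) (λ i → (- ½) * S (suc i)) k    ≡⟨ conv-scaleˡ (- ½) (S ∘ suc) _ k ⟨
    conv (λ i → (- ½) * S (suc i)) (λ i → (- ½) * S (suc i)) k  ≡⟨ conv-cong c≗-½*S∘suc c≗-½*S∘suc k ⟨
    conv c c k                     ∎
    where
    open ≡-Reasoning
    x y : ℚ
    x = S (suc (suc k))
    y = conv (S ∘ suc) (S ∘ suc) k
    rearrange : ∀ h x → (- ((x + x) * h)) * h ≡ (- h) * ((- h) * (- (x + x)))
    rearrange = solve 2 (λ h x → (:- ((x :+ x) :* h)) :* h := (:- h) :* ((:- h) :* (:- (x :+ x)))) refl
    cancel-x+x : ∀ x y → y ≡ (x + (y + x)) + (- (x + x))
    cancel-x+x = solve 2 (λ x y → y := (x :+ (y :+ x)) :+ (:- (x :+ x))) refl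
    y≡-[x+x] : y ≡ - (x + x)
    y≡-[x+x] = begin
      y                          ≡⟨ cancel-x+x x y ⟩
      (x + (y + x)) + (- (x + x)) ≡⟨ cong (_+ (- (x + x))) (S²-suc-suc k) ⟩
      0ℚ + (- (x + x))           ≡⟨ ℚP.+-identityˡ (- (x + x)) ⟩
      - (x + x)                  ∎

  power : ℕ → FPS
  power zero    = one
  power (suc k) = conv c (power k)

  power-zero : ∀ k → power k 0 ≡ 1ℚ
  power-zero zero    = refl
  power-zero (suc k) = trans (cong₂ _*_ c-zero (power-zero k)) (ℚP.*-identityˡ 1ℚ)

  power-suc-suc : ∀ k n → power (suc k) (suc n) ≡ power k (suc n) + power (suc (suc k)) n
  power-suc-suc k n = cong₂ _+_
    (trans (cong (_* power k (suc n)) c-zero) (ℚP.*-identityˡ (power k (suc n))))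
    (trans (conv-cong c-suc (λ _ → refl) n) (conv-assoc c c (power k) n))

  power-ballot : ∀ d a → power (suc d) a ≡ fromℕ (ballot d a)
  power-ballot d       zero    = power-zero (suc d)
  power-ballot zero    (suc a) = begin
    power 1 (suc a)                ≡⟨ power-suc-suc 0 a ⟩
    0ℚ + power 2 a                 ≡⟨ ℚP.+-identityˡ (power 2 a) ⟩
    power 2 a                      ≡⟨ power-ballot 1 a ⟩
    fromℕ (ballot 1 a)             ∎
    where open ≡-Reasoning
  power-ballot (suc d) (suc a) = begin
    power (suc (suc d)) (suc a)                          ≡⟨ power-suc-suc (suc d) a ⟩
    power (suc d) (suc a) + power (suc (suc (suc d))) a  ≡⟨ cong₂ _+_ (power-ballot d (suc a)) (power-ballot (suc (suc d)) a) ⟩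
    fromℕ (ballot d (suc a)) + fromℕ x                   ≡⟨ ℚP.+-comm (fromℕ (ballot d (suc a))) (fromℕ x) ⟩
    fromℕ x + fromℕ (ballot d (suc a))                   ≡⟨ fromℕ-+ x (ballot d (suc a)) ⟨
    fromℕ (x ℕ.+ ballot d (suc a))                       ∎
    where
    open ≡-Reasoning
    x : ℕ
    x = ballot (suc (suc d)) a

-- Closed form of the ballot numbers

private
  ballot-closed-step : ∀ a d x₁ x₂ A E K →
    x₁ ℕ.* (A ℕ.* (suc (suc (suc (a ℕ.+ d))) ℕ.* E)) ≡ suc (suc (suc d)) ℕ.* K →
    x₂ ℕ.* ((suc a ℕ.* A) ℕ.* E) ≡ suc d ℕ.* K →
    (x₁ ℕ.+ x₂) ℕ.* ((suc a ℕ.* A) ℕ.* (suc (suc (suc (a ℕ.+ d))) ℕ.* E))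
      ≡ suc (suc d) ℕ.* (suc (suc (suc (a ℕ.+ a ℕ.+ d))) ℕ.* K)
  ballot-closed-step a d x₁ x₂ A E K eq₁ eq₂ = begin
    (x₁ ℕ.+ x₂) ℕ.* ((suc a ℕ.* A) ℕ.* (s₃ ℕ.* E))
      ≡⟨ expand x₁ x₂ (suc a) A s₃ E ⟩
    suc a ℕ.* (x₁ ℕ.* (A ℕ.* (s₃ ℕ.* E))) ℕ.+ s₃ ℕ.* (x₂ ℕ.* ((suc a ℕ.* A) ℕ.* E))
      ≡⟨ cong₂ (λ u v → suc a ℕ.* u ℕ.+ s₃ ℕ.* v) eq₁ eq₂ ⟩
    suc a ℕ.* (suc (suc (suc d)) ℕ.* K) ℕ.+ s₃ ℕ.* (suc d ℕ.* K)
      ≡⟨ collect a d K ⟩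
    suc (suc d) ℕ.* (suc (suc (suc (a ℕ.+ a ℕ.+ d))) ℕ.* K) ∎
    where
    open ≡-Reasoning
    s₃ : ℕ
    s₃ = suc (suc (suc (a ℕ.+ d)))
    expand : ∀ x₁ x₂ b A s E → (x₁ ℕ.+ x₂) ℕ.* ((b ℕ.* A) ℕ.* (s ℕ.* E))
               ≡ b ℕ.* (x₁ ℕ.* (A ℕ.* (s ℕ.* E))) ℕ.+ s ℕ.* (x₂ ℕ.* ((b ℕ.* A) ℕ.* E))
    expand = ℕ-Tactic.solve-∀
    collect : ∀ a d K → suc a ℕ.* (suc (suc (suc d)) ℕ.* K) ℕ.+ suc (suc (suc (a ℕ.+ d))) ℕ.* (suc d ℕ.* K)
                ≡ suc (suc d) ℕ.* (suc (suc (suc (a ℕ.+ a ℕ.+ d))) ℕ.* K)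
    collect = ℕ-Tactic.solve-∀

ballot-closed : ∀ d a → ballot d a ℕ.* (a ! ℕ.* (suc (a ℕ.+ d)) !) ≡ suc d ℕ.* (a ℕ.+ a ℕ.+ d) !
ballot-closed d zero = trans (ℕP.*-identityˡ _) (ℕP.*-identityˡ _)
ballot-closed zero (suc a) = begin
  ballot 1 a ℕ.* (suc a ! ℕ.* suc (suc a ℕ.+ 0) !)   ≡⟨ cong (λ k → ballot 1 a ℕ.* (suc a ! ℕ.* suc k !)) (i₁ a) ⟩
  ballot 1 a ℕ.* ((suc a ℕ.* a !) ℕ.* suc (a ℕ.+ 1) !) ≡⟨ pull (ballot 1 a) (suc a) (a !) (suc (a ℕ.+ 1) !) ⟩
  suc a ℕ.* (ballot 1 a ℕ.* (a ! ℕ.* suc (a ℕ.+ 1) !)) ≡⟨ cong (suc a ℕ.*_) (ballot-closed 1 a) ⟩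
  suc a ℕ.* (2 ℕ.* (a ℕ.+ a ℕ.+ 1) !)                ≡⟨ double a ((a ℕ.+ a ℕ.+ 1) !) ⟩
  1 ℕ.* (suc (a ℕ.+ a ℕ.+ 1) ℕ.* (a ℕ.+ a ℕ.+ 1) !)   ≡⟨ cong (λ k → 1 ℕ.* k !) (i₂ a) ⟨
  1 ℕ.* (suc a ℕ.+ suc a ℕ.+ 0) !                    ∎
  where
  open ≡-Reasoning
  i₁ : ∀ a → suc a ℕ.+ 0 ≡ a ℕ.+ 1
  i₁ = ℕ-Tactic.solve-∀
  i₂ : ∀ a → suc a ℕ.+ suc a ℕ.+ 0 ≡ suc (a ℕ.+ a ℕ.+ 1)
  i₂ = ℕ-Tactic.solve-∀
  pull : ∀ x s A G → x ℕ.* ((s ℕ.* A) ℕ.* G) ≡ s ℕ.* (x ℕ.* (A ℕ.* G))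
  pull = ℕ-Tactic.solve-∀
  double : ∀ a H → suc a ℕ.* (2 ℕ.* H) ≡ 1 ℕ.* (suc (a ℕ.+ a ℕ.+ 1) ℕ.* H)
  double = ℕ-Tactic.solve-∀
ballot-closed (suc d) (suc a) = begin
  (ballot (suc (suc d)) a ℕ.+ ballot d (suc a)) ℕ.* (suc a ! ℕ.* suc (suc a ℕ.+ suc d) !)
    ≡⟨ cong (λ k → (ballot (suc (suc d)) a ℕ.+ ballot d (suc a)) ℕ.* (suc a ! ℕ.* k !)) (i₁ a d) ⟩
  (ballot (suc (suc d)) a ℕ.+ ballot d (suc a)) ℕ.* ((suc a ℕ.* a !) ℕ.* (suc (suc (suc (a ℕ.+ d))) ℕ.* E))
    ≡⟨ ballot-closed-step a d (ballot (suc (suc d)) a) (ballot d (suc a)) (a !) E K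
                          (reindex₁ (ballot-closed (suc (suc d)) a)) (reindex₂ (ballot-closed d (suc a))) ⟩
  suc (suc d) ℕ.* (suc (suc (suc (a ℕ.+ a ℕ.+ d))) ℕ.* K)
    ≡⟨ cong (λ k → suc (suc d) ℕ.* k !) (i₂ a d) ⟨
  suc (suc d) ℕ.* (suc a ℕ.+ suc a ℕ.+ suc d) !       ∎
  where
  open ≡-Reasoning
  E K : ℕ
  E = suc (suc (a ℕ.+ d)) !
  K = suc (suc (a ℕ.+ a ℕ.+ d)) !
  i₁ : ∀ a d → suc (suc a ℕ.+ suc d) ≡ suc (suc (suc (a ℕ.+ d)))
  i₁ = ℕ-Tactic.solve-∀
  i₂ : ∀ a d → suc a ℕ.+ suc a ℕ.+ suc d ≡ suc (suc (suc (a ℕ.+ a ℕ.+ d)))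
  i₂ = ℕ-Tactic.solve-∀
  i₃ : ∀ a d → suc (a ℕ.+ suc (suc d)) ≡ suc (suc (suc (a ℕ.+ d)))
  i₃ = ℕ-Tactic.solve-∀
  i₄ : ∀ a d → a ℕ.+ a ℕ.+ suc (suc d) ≡ suc (suc (a ℕ.+ a ℕ.+ d))
  i₄ = ℕ-Tactic.solve-∀
  i₅ : ∀ a d → suc a ℕ.+ suc a ℕ.+ d ≡ suc (suc (a ℕ.+ a ℕ.+ d))
  i₅ = ℕ-Tactic.solve-∀
  reindex₁ : ballot (suc (suc d)) a ℕ.* (a ! ℕ.* suc (a ℕ.+ suc (suc d)) !) ≡ suc (suc (suc d)) ℕ.* (a ℕ.+ a ℕ.+ suc (suc d)) !
           → ballot (suc (suc d)) a ℕ.* (a ! ℕ.* (suc (suc (suc (a ℕ.+ d))) ℕ.* E)) ≡ suc (suc (suc d)) ℕ.* K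
  reindex₁ = subst₂ (λ u v → ballot (suc (suc d)) a ℕ.* (a ! ℕ.* u !) ≡ suc (suc (suc d)) ℕ.* v !) (i₃ a d) (i₄ a d)
  reindex₂ : ballot d (suc a) ℕ.* (suc a ! ℕ.* suc (suc a ℕ.+ d) !) ≡ suc d ℕ.* (suc a ℕ.+ suc a ℕ.+ d) !
           → ballot d (suc a) ℕ.* ((suc a ℕ.* a !) ℕ.* E) ≡ suc d ℕ.* K
  reindex₂ = subst (λ v → ballot d (suc a) ℕ.* ((suc a ℕ.* a !) ℕ.* E) ≡ suc d ℕ.* v !) (i₅ a d)

ballot-odd-closed : ∀ m n → let N = n ℕ.+ m in
  N ! ℕ.* ((N ℕ.+ (N ℕ.+ 1) ℕ.+ 1) ! ℕ.* (m ℕ.+ 1) !)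
    ≡ ballot (suc (2 ℕ.* m)) n ℕ.* ((m ! ℕ.* n !) ℕ.* ((N ℕ.+ 1) ! ℕ.* (N ℕ.+ (m ℕ.+ 1) ℕ.+ 1) !))
ballot-odd-closed m n = begin
  N ! ℕ.* ((N ℕ.+ (N ℕ.+ 1) ℕ.+ 1) ! ℕ.* (m ℕ.+ 1) !)
    ≡⟨ cong₂ (λ u v → N ! ℕ.* (u ! ℕ.* v !)) (i₁ n m) (ℕP.+-comm m 1) ⟩
  N ! ℕ.* ((suc (n ℕ.+ n ℕ.+ d) ℕ.* H) ℕ.* (suc m ℕ.* m !))
    ≡⟨ shuffle₁ n m H (m !) (N !) ⟩
  (suc d ℕ.* H) ℕ.* (m ! ℕ.* (suc N ℕ.* N !))
    ≡⟨ cong (ℕ._* (m ! ℕ.* (suc N ℕ.* N !))) (ballot-closed d n) ⟨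
  (x ℕ.* (n ! ℕ.* G)) ℕ.* (m ! ℕ.* (suc N ℕ.* N !))
    ≡⟨ shuffle₂ x (n !) G (m !) (suc N ℕ.* N !) ⟩
  x ℕ.* ((m ! ℕ.* n !) ℕ.* ((suc N ℕ.* N !) ℕ.* G))
    ≡⟨ cong₂ (λ u v → x ℕ.* ((m ! ℕ.* n !) ℕ.* (u ! ℕ.* v !))) (ℕP.+-comm N 1) (i₂ n m) ⟨
  x ℕ.* ((m ! ℕ.* n !) ℕ.* ((N ℕ.+ 1) ! ℕ.* (N ℕ.+ (m ℕ.+ 1) ℕ.+ 1) !)) ∎
  where
  open ≡-Reasoning
  N d x H G : ℕ
  N = n ℕ.+ m
  d = suc (2 ℕ.* m)
  x = ballot d n
  H = (n ℕ.+ n ℕ.+ d) !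
  G = suc (n ℕ.+ d) !
  i₁ : ∀ n m → n ℕ.+ m ℕ.+ (n ℕ.+ m ℕ.+ 1) ℕ.+ 1 ≡ suc (n ℕ.+ n ℕ.+ suc (2 ℕ.* m))
  i₁ = ℕ-Tactic.solve-∀
  i₂ : ∀ n m → n ℕ.+ m ℕ.+ (m ℕ.+ 1) ℕ.+ 1 ≡ suc (n ℕ.+ suc (2 ℕ.* m))
  i₂ = ℕ-Tactic.solve-∀
  shuffle₁ : ∀ n m H M F → F ℕ.* ((suc (n ℕ.+ n ℕ.+ suc (2 ℕ.* m)) ℕ.* H) ℕ.* (suc m ℕ.* M))
               ≡ (suc (suc (2 ℕ.* m)) ℕ.* H) ℕ.* (M ℕ.* (suc (n ℕ.+ m) ℕ.* F))
  shuffle₁ = ℕ-Tactic.solve-∀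
  shuffle₂ : ∀ x A G M F → (x ℕ.* (A ℕ.* G)) ℕ.* (M ℕ.* F) ≡ x ℕ.* ((M ℕ.* A) ℕ.* (F ℕ.* G))
  shuffle₂ = ℕ-Tactic.solve-∀

prodFromTo-empty : ∀ a f → prodFromTo (suc a) a f ≡ 1ℚ
prodFromTo-empty zero    f = refl
prodFromTo-empty (suc a) f with suc (suc a) ℕ.≤? suc a
... | yes 2+a≤1+a = ⊥-elim (ℕP.<-irrefl refl 2+a≤1+a)
... | no _        = refl

prodFromTo-suc : ∀ a b f → a ≤ suc b → prodFromTo a (suc b) f ≡ prodFromTo a b f * f (suc b)
prodFromTo-suc a b f a≤1+b with a ℕ.≤? suc b
... | yes _     = refl
... | no a≰1+b  = ⊥-elim (a≰1+b a≤1+b)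

-- If f (k+1) = (L k / L (k+1)) · (R (k+1) / R k), the product telescopes to
-- (R b · L a) / (L b · R a); stated multiplied out, so that no division occurs.
prodFromTo-telescope : ∀ {a b} (f g L R : ℕ → ℚ) → a ≤′ b →
  (∀ k → k < b → f (suc k) * L (suc k) ≡ L k * g k) →
  (∀ k → k < b → R (suc k) ≡ R k * g k) →
  prodFromTo (suc a) b f * L b * R a ≡ R b * L a
prodFromTo-telescope {a} f g L R ℕ.≤′-refl _ _ = begin
  prodFromTo (suc a) a f * L a * R a  ≡⟨ cong (λ p → p * L a * R a) (prodFromTo-empty a f) ⟩
  1ℚ * L a * R a                      ≡⟨ unit-swap (L a) (R a) ⟩
  R a * L a                           ∎
  where
  open ≡-Reasoning
  unit-swap : ∀ x y → 1ℚ * x * y ≡ y * x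
  unit-swap x y = trans (cong (_* y) (ℚP.*-identityˡ x)) (ℚP.*-comm x y)
prodFromTo-telescope {a} f g L R (ℕ.≤′-step {b} a≤′b) f-step R-step = begin
  prodFromTo (suc a) (suc b) f * L (suc b) * R a
    ≡⟨ cong (λ p → p * L (suc b) * R a) (prodFromTo-suc (suc a) b f (ℕ.s≤s (ℕP.≤′⇒≤ a≤′b))) ⟩
  P * f (suc b) * L (suc b) * R a                 ≡⟨ assoc-mid P (f (suc b)) (L (suc b)) (R a) ⟩
  P * (f (suc b) * L (suc b)) * R a               ≡⟨ cong (λ x → P * x * R a) (f-step b ℕP.≤-refl) ⟩
  P * (L b * g b) * R a                           ≡⟨ pull-out P (L b) (g b) (R a) ⟩
  P * L b * R a * g b                             ≡⟨ cong (_* g b) (prodFromTo-telescope f g L R a≤′b (weaken f-step) (weaken R-step)) ⟩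
  R b * L a * g b                                 ≡⟨ *-Properties.xy∙z≈xz∙y (R b) (L a) (g b) ⟩
  R b * g b * L a                                 ≡⟨ cong (_* L a) (R-step b ℕP.≤-refl) ⟨
  R (suc b) * L a                                 ∎
  where
  open ≡-Reasoning
  P : ℚ
  P = prodFromTo (suc a) b f
  weaken : ∀ {P : ℕ → Set} → (∀ k → k < suc b → P k) → ∀ k → k < b → P k
  weaken h k = h k ∘ ℕP.m<n⇒m<1+n
  assoc-mid : ∀ p x y z → p * x * y * z ≡ p * (x * y) * z
  assoc-mid p x y z = cong (_* z) (ℚP.*-assoc p x y)
  pull-out : ∀ p x y z → p * (x * y) * z ≡ p * x * z * y
  pull-out = solve 4 (λ p x y z → p :* (x :* y) :* z := p :* x :* z :* y) refl

prodFromTo-falling : ∀ N m f → m ≤ N → (∀ k → f (suc k) ≡ + (N ∸ suc k ℕ.+ 1) / suc k) →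
  prodFromTo 1 m f * fromℕ (m ! ℕ.* (N ∸ m) !) ≡ fromℕ (N !)
prodFromTo-falling N m f m≤N f-def = begin
  prodFromTo 1 m f * L m                   ≡⟨ ℚP.*-identityʳ _ ⟨
  prodFromTo 1 m f * L m * 1ℚ              ≡⟨ prodFromTo-telescope f (const 1ℚ) L (const 1ℚ) ℕP.z≤′n step (λ _ _ → refl) ⟩
  1ℚ * L 0                                 ≡⟨ ℚP.*-identityˡ (L 0) ⟩
  fromℕ (1 ℕ.* N !)                        ≡⟨ cong fromℕ (ℕP.*-identityˡ (N !)) ⟩
  fromℕ (N !)                              ∎
  where
  open ≡-Reasoning
  L : ℕ → ℚ
  L k = fromℕ (k ! ℕ.* (N ∸ k) !)
  step : ∀ k → k < m → f (suc k) * L (suc k) ≡ L k * 1ℚ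
  step k k<m = begin
    f (suc k) * L (suc k)                        ≡⟨ cong (_* L (suc k)) (f-def k) ⟩
    (+ (r ℕ.+ 1) / suc k) * L (suc k)            ≡⟨ ℚP.*-comm (+ (r ℕ.+ 1) / suc k) (L (suc k)) ⟩
    L (suc k) * (+ (r ℕ.+ 1) / suc k)            ≡⟨ fromℕ-*-/ (suc k ! ℕ.* r !) (r ℕ.+ 1) (k ! ℕ.* (N ∸ k) !) k cross ⟩
    L k                                          ≡⟨ ℚP.*-identityʳ (L k) ⟨
    L k * 1ℚ                                     ∎
    where
    r : ℕ
    r = N ∸ suc k
    N∸k≡1+r : N ∸ k ≡ suc r
    N∸k≡1+r = ℕP.+-∸-assoc 1 (ℕP.≤-trans k<m m≤N)
    shuffle : ∀ k r K R → (suc k ℕ.* K) ℕ.* R ℕ.* (r ℕ.+ 1) ≡ K ℕ.* (suc r ℕ.* R) ℕ.* suc k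
    shuffle = ℕ-Tactic.solve-∀
    cross : suc k ! ℕ.* r ! ℕ.* (r ℕ.+ 1) ≡ k ! ℕ.* (N ∸ k) ! ℕ.* suc k
    cross = trans (shuffle k r (k !) (r !)) (cong (λ x → k ! ℕ.* x ! ℕ.* suc k) (sym N∸k≡1+r))

prodFromTo-rising : ∀ K a b f → a ≤′ b → (∀ k → f (suc k) ≡ + (K ℕ.+ suc k ℕ.+ 1) / suc k) →
  prodFromTo (suc a) b f * fromℕ (b !) * fromℕ ((K ℕ.+ a ℕ.+ 1) !) ≡ fromℕ ((K ℕ.+ b ℕ.+ 1) !) * fromℕ (a !)
prodFromTo-rising K a b f a≤′b f-def = prodFromTo-telescope f g (λ k → fromℕ (k !)) R a≤′b f-step R-step
  where
  open ≡-Reasoning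
  g R : ℕ → ℚ
  g k = fromℕ (K ℕ.+ suc k ℕ.+ 1)
  R k = fromℕ ((K ℕ.+ k ℕ.+ 1) !)
  index : ∀ K k → K ℕ.+ suc k ℕ.+ 1 ≡ suc (K ℕ.+ k ℕ.+ 1)
  index = ℕ-Tactic.solve-∀
  f-step : ∀ k → k < b → f (suc k) * fromℕ (suc k !) ≡ fromℕ (k !) * g k
  f-step k _ = begin
    f (suc k) * fromℕ (suc k !)                  ≡⟨ cong (_* fromℕ (suc k !)) (f-def k) ⟩
    (+ y / suc k) * fromℕ (suc k !)              ≡⟨ ℚP.*-comm (+ y / suc k) (fromℕ (suc k !)) ⟩
    fromℕ (suc k !) * (+ y / suc k)              ≡⟨ fromℕ-*-/ (suc k !) y (k ! ℕ.* y) k (shuffle k (k !) y) ⟩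
    fromℕ (k ! ℕ.* y)                            ≡⟨ fromℕ-* (k !) y ⟩
    fromℕ (k !) * g k                            ∎
    where
    y : ℕ
    y = K ℕ.+ suc k ℕ.+ 1
    shuffle : ∀ k F y → suc k ℕ.* F ℕ.* y ≡ F ℕ.* y ℕ.* suc k
    shuffle = ℕ-Tactic.solve-∀
  R-step : ∀ k → k < b → R (suc k) ≡ R k * g k
  R-step k _ = begin
    fromℕ ((K ℕ.+ suc k ℕ.+ 1) !)                 ≡⟨ cong (λ x → fromℕ (x !)) (index K k) ⟩
    fromℕ (suc x ℕ.* x !)                         ≡⟨ cong fromℕ (ℕP.*-comm (suc x) (x !)) ⟩
    fromℕ (x ! ℕ.* suc x)                         ≡⟨ fromℕ-* (x !) (suc x) ⟩
    R k * fromℕ (suc x)                           ≡⟨ cong (λ z → R k * fromℕ z) (index K k) ⟨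
    R k * g k                                     ∎
    where
    x : ℕ
    x = K ℕ.+ k ℕ.+ 1

-- The factors of B are local functions in Defs, so they enter through their defining equations.
B-factors-closed : ∀ m n f₁ f₂ →
  (∀ k → f₁ (suc k) ≡ + (n ℕ.+ m ∸ suc k ℕ.+ 1) / suc k) →
  (∀ k → f₂ (suc k) ≡ + (n ℕ.+ m ℕ.+ suc k ℕ.+ 1) / suc k) →
  prodFromTo 1 m f₁ * prodFromTo (m ℕ.+ 2) (n ℕ.+ m ℕ.+ 1) f₂ ≡ fromℕ (ballot (suc (2 ℕ.* m)) n)
B-factors-closed m n f₁ f₂ f₁-def f₂-def = *-cancelʳ-fromℕ (A ℕ.* D) {{A*D≢0}} (begin
  P₁ * P₂ * fromℕ (A ℕ.* D)
    ≡⟨ cong (P₁ * P₂ *_) (trans (fromℕ-* A D) (cong (fromℕ A *_) (fromℕ-* (N+1 !) (Rm !)))) ⟩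
  P₁ * P₂ * (fromℕ A * (fromℕ (N+1 !) * fromℕ (Rm !)))
    ≡⟨ regroup P₁ P₂ (fromℕ A) (fromℕ (N+1 !)) (fromℕ (Rm !)) ⟩
  (P₁ * fromℕ A) * (P₂ * fromℕ (N+1 !) * fromℕ (Rm !))
    ≡⟨ cong₂ _*_ falling rising ⟩
  fromℕ (N !) * (fromℕ (Rt !) * fromℕ ((m ℕ.+ 1) !))
    ≡⟨ trans (fromℕ-* (N !) (Rt ! ℕ.* (m ℕ.+ 1) !)) (cong (fromℕ (N !) *_) (fromℕ-* (Rt !) ((m ℕ.+ 1) !))) ⟨
  fromℕ (N ! ℕ.* (Rt ! ℕ.* (m ℕ.+ 1) !))
    ≡⟨ cong fromℕ (ballot-odd-closed m n) ⟩
  fromℕ (x ℕ.* (m ! ℕ.* n ! ℕ.* D))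
    ≡⟨ cong (λ k → fromℕ (x ℕ.* (m ! ℕ.* k ! ℕ.* D))) N∸m≡n ⟨
  fromℕ (x ℕ.* (A ℕ.* D))
    ≡⟨ fromℕ-* x (A ℕ.* D) ⟩
  fromℕ x * fromℕ (A ℕ.* D) ∎)
  where
  open ≡-Reasoning
  x N N+1 Rm Rt A D : ℕ
  x = ballot (suc (2 ℕ.* m)) n
  N = n ℕ.+ m
  N+1 = N ℕ.+ 1
  Rm = N ℕ.+ (m ℕ.+ 1) ℕ.+ 1
  Rt = N ℕ.+ N+1 ℕ.+ 1
  A = m ! ℕ.* (N ∸ m) !
  D = N+1 ! ℕ.* Rm !
  A*D≢0 : NonZero (A ℕ.* D)
  A*D≢0 = ℕP.m*n≢0 A D {{ℕP._!*_!≢0 m (N ∸ m)}} {{ℕP._!*_!≢0 N+1 Rm}}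
  N∸m≡n : N ∸ m ≡ n
  N∸m≡n = ℕP.m+n∸n≡m n m
  P₁ P₂ : ℚ
  P₁ = prodFromTo 1 m f₁
  P₂ = prodFromTo (m ℕ.+ 2) N+1 f₂
  falling : P₁ * fromℕ A ≡ fromℕ (N !)
  falling = prodFromTo-falling N m f₁ (ℕP.m≤n+m m n) f₁-def
  rising : P₂ * fromℕ (N+1 !) * fromℕ (Rm !) ≡ fromℕ (Rt !) * fromℕ ((m ℕ.+ 1) !)
  rising = trans (cong (λ a → prodFromTo a N+1 f₂ * fromℕ (N+1 !) * fromℕ (Rm !)) (ℕP.+-suc m 1))
                 (prodFromTo-rising N (m ℕ.+ 1) N+1 f₂ (ℕP.≤⇒≤′ (ℕP.+-monoˡ-≤ 1 (ℕP.m≤n+m m n))) f₂-def)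
  regroup : ∀ p q a b c → p * q * (a * (b * c)) ≡ (p * a) * (q * b * c)
  regroup = solve 5 (λ p q a b c → p :* q :* (a :* (b :* c)) := (p :* a) :* (q :* b :* c)) refl

B-ballot : ∀ m n → B m n ≡ fromℕ (ballot (suc (2 ℕ.* m)) n)
B-ballot m zero    = refl
B-ballot m (suc n) = B-factors-closed m (suc n) _ _ (λ _ → refl) (λ _ → refl)

theorem7p1 : (m : ℕ) → 1 ≤ m →
    (S T : FPS) → S 0 ≡ 1ℚ → (∀ n → (S ⋆ S) n ≡ oneMinus4x n) →
    (∀ n → (T ⋆ oneMinusOver2x S) n ≡ one n) →
    ∀ n → γ m n ≡ (T ⋆ B m) n
-- Nothing here needs 1 ≤ m: the identity holds for m = 0 too (γ_0 = c, B 0 = c²).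
theorem7p1 m _ S T S₀≡1 S²≡1-4x T⋆c≡1 n = begin
  γ m n                             ≡⟨ cong fromℕ (C≡ballot n m) ⟩
  fromℕ (ballot (2 ℕ.* m) n)        ≡⟨ power-ballot (2 ℕ.* m) n ⟨
  c^[2m+1] n                        ≡⟨ conv-identityˡ c^[2m+1] n ⟨
  conv one c^[2m+1] n               ≡⟨ conv-cong T*c≗one (λ _ → refl) n ⟨
  conv (conv T c) c^[2m+1] n        ≡⟨ conv-assoc T c c^[2m+1] n ⟩
  conv T (conv c c^[2m+1]) n        ≡⟨ conv-cong (λ _ → refl) c^[2m+2]≗B n ⟩
  conv T (B m) n                    ≡⟨ ⋆≗conv T (B m) n ⟨
  (T ⋆ B m) n                       ∎
  where
  open ≡-Reasoning
  open CatalanSeries S S₀≡1 S²≡1-4x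
  c^[2m+1] : FPS
  c^[2m+1] = power (suc (2 ℕ.* m))
  T*c≗one : conv T c ≗ one
  T*c≗one i = trans (sym (⋆≗conv T c i)) (T⋆c≡1 i)
  c^[2m+2]≗B : power (suc (suc (2 ℕ.* m))) ≗ B m
  c^[2m+2]≗B i = trans (power-ballot (suc (2 ℕ.* m)) i) (sym (B-ballot m i))
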